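{- Let $r,n,s_1,\ldots,s_r$ be positive integers with $r\leq n$. If $n\geq 2$, then the odd multiple harmonic star sum $$\overline{H}_n^{\star}(s_1,\ldots,s_r)=\sum_{0\leq k_1\leq k_2\leq \cdots\leq k_r\leq n-1}\prod_{j=1}^{r}\frac{1}{(2k_j+1)^{s_j}}$$ is not an integer. -}

module Defs where

open import Data.Nat as ℕ using (ℕ; zero; suc; _+_; _^_; _∸_)
open import Data.Nat.Properties using (m^n≢0)
open import Data.Integer using (ℤ; +_)
open import Data.Rational using (ℚ; _/_; 0ℚ; 1ℚ) renaming (_+_ to _+ℚ_; _*_ to _*ℚ_)
open import Data.Vec using (Vec; []; _∷_)

oddInvPow : (k s : ℕ) → ℚ
oddInvPow k s = (+ 1 / ((suc (k + k)) ^ s)) {{m^n≢0 (suc (k + k)) s}}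

sumFrom : (lo n : ℕ) → (ℕ → ℚ) → ℚ
sumFrom lo n f = go (n ∸ lo) lo
  where
  go : ℕ → ℕ → ℚ
  go zero    k = 0ℚ
  go (suc m) k = f k +ℚ go m (suc k)

-- starSumFrom n lo (s₁ ∷ … ∷ s_r)
--   = Σ_{lo ≤ k₁ ≤ k₂ ≤ … ≤ k_r ≤ n-1} Π_j 1/(2k_j+1)^{s_j}
starSumFrom : ∀ {r} → (n lo : ℕ) → Vec ℕ r → ℚ
starSumFrom n lo []       = 1ℚ
starSumFrom n lo (s ∷ ss) = sumFrom lo n (λ k → oddInvPow k s *ℚ starSumFrom n k ss)

oddMHStarSum : ∀ {r} → ℕ → Vec ℕ r → ℚ
oddMHStarSum n s = starSumFrom n 0 s

IsInteger : ℚ → Set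
IsInteger q = Data.Product.∃ λ (z : ℤ) → q Relation.Binary.PropositionalEquality.≡ (z / 1)
  where import Data.Product
        import Relation.Binary.PropositionalEquality

-- Let 3^a = 2m+1 be the largest power of 3 below 2n.  Among the odd numbers 1, 3, …, 2n-1 only
-- 3^a itself is divisible by 3^a: 2·3^a is even and 3·3^a exceeds 2n-1.  Multiply the sum by
-- 3^(a(s₁+⋯+s_r)).  Each factor 3^(a s)/(2k+1)^s becomes 3-integral; it is 1 for k = m and
-- divisible by 3 otherwise.  So the scaled sum is ≡ 1 (mod 3), the tuple k₁ = ⋯ = k_r = m being
-- the only one without a factor 3, whereas the scaled version of an integer is ≡ 0 (mod 3).
module Submission where

open import Defs
open import Algebra.Bundles using (CommutativeMonoid)
import Algebra.Properties.CommutativeSemigroup as CommSemigroupProperties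
open import Data.Bool.Base using (if_then_else_)
open import Data.Empty using (⊥-elim)
open import Data.Fin using (zero; suc)
open import Data.Integer as ℤ using (+_)
import Data.Integer.Properties as ℤ
open import Data.Nat
  using (ℕ; zero; suc; _+_; _*_; _^_; _∸_; _≤_; _≥_; _<_; z≤n; s≤s; NonZero; _≤?_; _<?_
        ; nonTrivial⇒≢1; >-nonZero)
import Data.Nat.Properties as ℕ
open import Data.Nat.DivMod using (_%_; m*n%n≡0; [m+kn]%n≡m%n)
open import Data.Nat.Divisibility
  using (_∣_; _∣?_; divides; quotient-<; ∣1⇒≡1; ∣m+n∣m⇒∣n; n∣m*n; m∣m*n; ∣m⇒∣m*n)
open import Data.Nat.Induction using (<-rec)
open import Data.Nat.Primality using (Prime; prime?; euclidsLemma; prime⇒nonTrivial)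
open import Data.Nat.Tactic.RingSolver using (solve-∀)
open import Data.Product using (∃; ∃₂; _×_; _,_)
open import Data.Rational as ℚ using (ℚ; _/_; 0ℚ; 1ℚ; fromℚᵘ)
import Data.Rational.Properties as ℚ
open import Data.Rational.Unnormalised as ℚᵘ using (mkℚᵘ; *≡*)
import Data.Rational.Unnormalised.Properties as ℚᵘ
open import Data.Sum using (inj₁; inj₂)
open import Data.Vec using (Vec; []; _∷_; lookup; sum)
open import Relation.Binary.Definitions using (tri<; tri≈; tri>)
open import Relation.Binary.PropositionalEquality
open import Relation.Nullary using (¬_; does; yes; no)
open import Relation.Nullary.Decidable using (dec-true; dec-false; from-yes)

fromℚᵘ-homo-+ : ∀ p q → fromℚᵘ p ℚ.+ fromℚᵘ q ≡ fromℚᵘ (p ℚᵘ.+ q)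
fromℚᵘ-homo-+ p q = ℚ.toℚᵘ-injective (ℚᵘ.≃-trans (ℚ.toℚᵘ-homo-+ (fromℚᵘ p) (fromℚᵘ q))
  (ℚᵘ.≃-trans (ℚᵘ.+-cong (ℚ.toℚᵘ-fromℚᵘ p) (ℚ.toℚᵘ-fromℚᵘ q))
              (ℚᵘ.≃-sym (ℚ.toℚᵘ-fromℚᵘ (p ℚᵘ.+ q)))))

fromℚᵘ-homo-* : ∀ p q → fromℚᵘ p ℚ.* fromℚᵘ q ≡ fromℚᵘ (p ℚᵘ.* q)
fromℚᵘ-homo-* p q = ℚ.toℚᵘ-injective (ℚᵘ.≃-trans (ℚ.toℚᵘ-homo-* (fromℚᵘ p) (fromℚᵘ q))
  (ℚᵘ.≃-trans (ℚᵘ.*-cong (ℚ.toℚᵘ-fromℚᵘ p) (ℚ.toℚᵘ-fromℚᵘ q))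
              (ℚᵘ.≃-sym (ℚ.toℚᵘ-fromℚᵘ (p ℚᵘ.* q)))))

+/-+ : ∀ a b c d → (+ a / suc b) ℚ.+ (+ c / suc d) ≡ + (a * suc d + c * suc b) / (suc b * suc d)
+/-+ a b c d = trans (fromℚᵘ-homo-+ (mkℚᵘ (+ a) b) (mkℚᵘ (+ c) d))
                     (cong (_/ (suc b * suc d)) numerator)
  where
  numerator : + a ℤ.* + suc d ℤ.+ + c ℤ.* + suc b ≡ + (a * suc d + c * suc b)
  numerator = trans (cong₂ ℤ._+_ (sym (ℤ.pos-* a (suc d))) (sym (ℤ.pos-* c (suc b))))
                    (sym (ℤ.pos-+ (a * suc d) (c * suc b)))

+/-* : ∀ a b c d → (+ a / suc b) ℚ.* (+ c / suc d) ≡ + (a * c) / (suc b * suc d)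
+/-* a b c d = trans (fromℚᵘ-homo-* (mkℚᵘ (+ a) b) (mkℚᵘ (+ c) d))
                     (cong (_/ (suc b * suc d)) (sym (ℤ.pos-* a c)))

+/1-*-1/ : ∀ a b .{{_ : NonZero b}} → (+ a / 1) ℚ.* (+ 1 / b) ≡ + a / b
+/1-*-1/ a (suc b) = trans (+/-* a 0 1 b) (ℚ./-cong (cong +_ (ℕ.*-identityʳ a)) (ℕ.*-identityˡ (suc b)))

+/-cross : ∀ a b c d .{{_ : NonZero b}} .{{_ : NonZero d}} → a * d ≡ c * b → + a / b ≡ + c / d
+/-cross a (suc b) c (suc d) eq = ℚ.fromℚᵘ-cong {mkℚᵘ (+ a) b} {mkℚᵘ (+ c) d}
  (*≡* (trans (sym (ℤ.pos-* a (suc d))) (trans (cong +_ eq) (ℤ.pos-* c (suc b)))))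

sumFrom-≥ : ∀ {lo n} (f : ℕ → ℚ) → n ≤ lo → sumFrom lo n f ≡ 0ℚ
sumFrom-≥ f n≤lo rewrite ℕ.m≤n⇒m∸n≡0 n≤lo = refl

sumFrom-< : ∀ {lo n} (f : ℕ → ℚ) → lo < n → sumFrom lo n f ≡ f lo ℚ.+ sumFrom (suc lo) n f
sumFrom-< f (s≤s lo≤n) rewrite ℕ.+-∸-assoc 1 lo≤n = refl

downwardInduction : ∀ {ℓ} (P : ℕ → Set ℓ) n → (∀ k → n ≤ k → P k) →
                    (∀ k → k < n → P (suc k) → P k) → ∀ k → P k
downwardInduction P zero    base step k = base k z≤n
downwardInduction P (suc n) base step   = downwardInduction P n base′ (λ k k<n → step k (ℕ.m<n⇒m<1+n k<n))
  where
  base′ : ∀ k → n ≤ k → P k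
  base′ k n≤k with ℕ.m≤n⇒m<n∨m≡n n≤k
  ... | inj₁ n<k  = base k n<k
  ... | inj₂ refl = step n (ℕ.n<1+n n) (base (suc n) ℕ.≤-refl)

sumFrom-*ˡ : ∀ c {f g : ℕ → ℚ} lo n → (∀ k → c ℚ.* f k ≡ g k) →
             c ℚ.* sumFrom lo n f ≡ sumFrom lo n g
sumFrom-*ˡ c {f} {g} lo n cf≡g = downwardInduction P n base step lo
  where
  P : ℕ → Set
  P k = c ℚ.* sumFrom k n f ≡ sumFrom k n g
  base : ∀ k → n ≤ k → P k
  base k n≤k rewrite sumFrom-≥ f n≤k | sumFrom-≥ g n≤k = ℚ.*-zeroʳ c
  step : ∀ k → k < n → P (suc k) → P k
  step k k<n ih rewrite sumFrom-< f k<n | sumFrom-< g k<n =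
    trans (ℚ.*-distribˡ-+ c (f k) (sumFrom (suc k) n f)) (cong₂ ℚ._+_ (cf≡g k) ih)

private
  sum-numerator : ∀ p a b x y D E → (a * D + x * p) * E + (b * E + y * p) * D
                                    ≡ (a + b) * (D * E) + (x * E + y * D) * p
  sum-numerator = solve-∀

  product-numerator : ∀ p a b x y D E → (a * D + x * p) * (b * E + y * p)
                                        ≡ a * b * (D * E) + (a * D * y + x * (b * E) + x * y * p) * p
  product-numerator = solve-∀

  power-split : ∀ p P Q u → P * (p * Q) * u ≡ Q * p * (P * u)
  power-split = solve-∀

  power-shift : ∀ p P u → P * u * p ≡ p * P * u
  power-shift = solve-∀

module Residue {p : ℕ} (p-prime : Prime p) where

  -- q = (c·D + x·p)/D with p ∤ D: q is a nonnegative p-integral rational congruent to c mod p.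
  record HasResidue (q : ℚ) (c : ℕ) : Set where
    constructor residue
    field
      x d : ℕ
      p∤denominator : ¬ p ∣ suc d
      fraction : q ≡ + (c * suc d + x * p) / suc d

  p∤1 : ¬ p ∣ 1
  p∤1 p∣1 = nonTrivial⇒≢1 {{prime⇒nonTrivial p-prime}} (∣1⇒≡1 p∣1)

  p∤* : ∀ {m n} → ¬ p ∣ m → ¬ p ∣ n → ¬ p ∣ m * n
  p∤* {m} {n} p∤m p∤n p∣mn with euclidsLemma m n p-prime p∣mn
  ... | inj₁ p∣m = p∤m p∣m
  ... | inj₂ p∣n = p∤n p∣n

  p∤^ : ∀ {u} s → ¬ p ∣ u → ¬ p ∣ u ^ s
  p∤^ zero    p∤u = p∤1
  p∤^ (suc s) p∤u = p∤* p∤u (p∤^ s p∤u)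

  0-hasResidue-0 : HasResidue 0ℚ 0
  0-hasResidue-0 = residue 0 0 p∤1 refl

  1-hasResidue-1 : HasResidue 1ℚ 1
  1-hasResidue-1 = residue 0 0 p∤1 refl

  HasResidue-+ : ∀ {q r a b} → HasResidue q a → HasResidue r b → HasResidue (q ℚ.+ r) (a + b)
  HasResidue-+ {a = a} {b} (residue x d p∤D q≡) (residue y e p∤E r≡) =
    residue (x * suc e + y * suc d) (e + d * suc e) (p∤* p∤D p∤E)
    (trans (cong₂ ℚ._+_ q≡ r≡)
      (trans (+/-+ (a * suc d + x * p) d (b * suc e + y * p) e)
             (cong (λ N → + N / (suc d * suc e)) (sum-numerator p a b x y (suc d) (suc e)))))

  HasResidue-* : ∀ {q r a b} → HasResidue q a → HasResidue r b → HasResidue (q ℚ.* r) (a * b)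
  HasResidue-* {a = a} {b} (residue x d p∤D q≡) (residue y e p∤E r≡) =
    residue (a * suc d * y + x * (b * suc e) + x * y * p) (e + d * suc e) (p∤* p∤D p∤E)
    (trans (cong₂ ℚ._*_ q≡ r≡)
      (trans (+/-* (a * suc d + x * p) d (b * suc e + y * p) e)
             (cong (λ N → + N / (suc d * suc e)) (product-numerator p a b x y (suc d) (suc e)))))

  fraction-hasResidue : ∀ N D .{{_ : NonZero D}} c x d → ¬ p ∣ suc d →
                        N * suc d ≡ (c * suc d + x * p) * D → HasResidue (+ N / D) c
  fraction-hasResidue N D c x d p∤ eq = residue x d p∤ (+/-cross N D (c * suc d + x * p) (suc d) eq)

  ≡-hasResidue-1 : ∀ N D .{{_ : NonZero D}} → N ≡ D → HasResidue (+ N / D) 1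
  ≡-hasResidue-1 N D N≡D =
    fraction-hasResidue N D 1 0 0 p∤1 (trans (ℕ.*-identityʳ N) (trans N≡D (sym (ℕ.*-identityˡ D))))

  p^/-hasResidue-0 : ∀ e w u D .{{_ : NonZero D}} → D ≡ p ^ w * u → ¬ p ∣ u → w < e →
                     HasResidue (+ (p ^ e) / D) 0
  p^/-hasResidue-0 e w zero    D D≡ p∤u w<e = ⊥-elim (p∤u (divides 0 refl))
  p^/-hasResidue-0 e w (suc d) D D≡ p∤u w<e = fraction-hasResidue (p ^ e) D 0 (p ^ j) d p∤u (begin
    p ^ e * suc d                  ≡⟨ cong (λ e → p ^ e * suc d) e≡w+1+j ⟩
    p ^ (w + suc j) * suc d        ≡⟨ cong (_* suc d) (ℕ.^-distribˡ-+-* p w (suc j)) ⟩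
    p ^ w * (p * p ^ j) * suc d    ≡⟨ power-split p (p ^ w) (p ^ j) (suc d) ⟩
    p ^ j * p * (p ^ w * suc d)    ≡⟨ cong (p ^ j * p *_) (sym D≡) ⟩
    p ^ j * p * D                  ∎)
    where
    open ≡-Reasoning
    j : ℕ
    j = e ∸ suc w
    e≡w+1+j : e ≡ w + suc j
    e≡w+1+j = trans (sym (ℕ.m+[n∸m]≡n w<e)) (sym (ℕ.+-suc w j))

  multiple-¬hasResidue-1 : ∀ N z → p ∣ N → ¬ HasResidue ((+ N / 1) ℚ.* (z / 1)) 1
  multiple-¬hasResidue-1 N z p∣N (residue x d p∤D eq) =
    p∤D (subst (p ∣_) (ℕ.*-identityˡ (suc d)) (∣m+n∣m⇒∣n p∣x*p+D (n∣m*n x)))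
    where
    M : ℕ
    M = 1 * suc d + x * p
    cross : (+ N ℤ.* z) ℤ.* + suc d ≡ + M ℤ.* + 1
    cross with ℚ.fromℚᵘ-injective {mkℚᵘ (+ N) 0 ℚᵘ.* mkℚᵘ z 0} {mkℚᵘ (+ M) d}
                 (trans (sym (fromℚᵘ-homo-* (mkℚᵘ (+ N) 0) (mkℚᵘ z 0))) eq)
    ... | *≡* e = e
    N∣z∣D≡M : N * ℤ.∣ z ∣ * suc d ≡ M * 1
    N∣z∣D≡M = trans (sym (trans (ℤ.abs-* (+ N ℤ.* z) (+ suc d)) (cong (_* suc d) (ℤ.abs-* (+ N) z))))
                    (trans (cong ℤ.∣_∣ cross) (ℤ.abs-* (+ M) (+ 1)))
    p∣x*p+D : p ∣ x * p + 1 * suc d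
    p∣x*p+D = subst (p ∣_) (trans N∣z∣D≡M (trans (ℕ.*-identityʳ M) (ℕ.+-comm (1 * suc d) (x * p))))
                    (∣m⇒∣m*n (suc d) (∣m⇒∣m*n ℤ.∣ z ∣ p∣N))

  p-power-decomposition : ∀ D → 0 < D → ∃₂ λ v u → D ≡ p ^ v * u × ¬ p ∣ u
  p-power-decomposition = <-rec _ decompose
    where
    decompose : ∀ D → (∀ {q} → q < D → 0 < q → ∃₂ λ v u → q ≡ p ^ v * u × ¬ p ∣ u) →
                0 < D → ∃₂ λ v u → D ≡ p ^ v * u × ¬ p ∣ u
    decompose D rec 0<D with p ∣? D
    ... | no p∤D = 0 , D , sym (ℕ.*-identityˡ D) , p∤D
    ... | yes p∣D@(divides zero D≡0) = ⊥-elim (ℕ.<-irrefl (sym D≡0) 0<D)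
    ... | yes p∣D@(divides q@(suc _) D≡q*p)
        with rec (quotient-< p∣D {{prime⇒nonTrivial p-prime}} {{>-nonZero 0<D}}) (s≤s z≤n)
    ...   | v , u , q≡ , p∤u =
          suc v , u , trans D≡q*p (trans (cong (_* p) q≡) (power-shift p (p ^ v) u)) , p∤u

∣^ : ∀ {m e} → 1 ≤ e → m ∣ m ^ e
∣^ {m} {suc e} _ = m∣m*n (m ^ e)

prime[3] : Prime 3
prime[3] = from-yes (prime? 3)

pow-bracket : ∀ b → 1 < b → ∀ N → 0 < N → ∃ λ a → b ^ a ≤ N × N < b ^ suc a
pow-bracket b 1<b (suc zero)    _ = 0 , ℕ.≤-refl , subst (1 <_) (sym (ℕ.*-identityʳ b)) 1<b
pow-bracket b 1<b (suc (suc N)) _ with pow-bracket b 1<b (suc N) (s≤s z≤n)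
... | a , b^a≤ , <b^[1+a] with suc (suc N) <? b ^ suc a
...   | yes <b^[1+a]′ = a , ℕ.m≤n⇒m≤1+n b^a≤ , <b^[1+a]′
...   | no  ≮b^[1+a]  = suc a , ℕ.≮⇒≥ ≮b^[1+a] ,
                        subst₂ _<_ b^[1+a]≡ (ℕ.*-comm (b ^ suc a) b) (ℕ.m<m*n (b ^ suc a) b 1<b)
  where
  instance
    b^[1+a]≢0 : NonZero (b ^ suc a)
    b^[1+a]≢0 = >-nonZero (ℕ.<-≤-trans (s≤s z≤n) <b^[1+a])
  b^[1+a]≡ : b ^ suc a ≡ suc (suc N)
  b^[1+a]≡ = ℕ.≤-antisym (ℕ.≮⇒≥ ≮b^[1+a]) <b^[1+a]

3^-odd : ∀ a → ∃ λ m → suc (m + m) ≡ 3 ^ a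
3^-odd zero = 0 , refl
3^-odd (suc a) with 3^-odd a
... | m , 2m+1≡3^a = suc (3 * m) , trans (triple m) (cong (3 *_) 2m+1≡3^a)
  where
  triple : ∀ m → suc (suc (3 * m) + suc (3 * m)) ≡ 3 * suc (m + m)
  triple = solve-∀

^-distribʳ-* : ∀ m n o → (m * n) ^ o ≡ m ^ o * n ^ o
^-distribʳ-* m n zero    = refl
^-distribʳ-* m n (suc o) = trans (cong (m * n *_) (^-distribʳ-* m n o)) (interchange m n (m ^ o) (n ^ o))
  where
  interchange : ∀ a b c d → a * b * (c * d) ≡ a * c * (b * d)
  interchange = solve-∀

private
  k+k≡k*2 : ∀ k → k + k ≡ k * 2
  k+k≡k*2 = solve-∀

double-injective : ∀ {k m} → k + k ≡ m + m → k ≡ m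
double-injective {k} {m} eq = ℕ.*-cancelʳ-≡ k m 2 (trans (sym (k+k≡k*2 k)) (trans eq (k+k≡k*2 m)))

odd≢even : ∀ k x → suc (k + k) ≢ x * 2
odd≢even k x eq = ℕ.0≢1+n (trans (sym (m*n%n≡0 x 2)) (trans (cong (_% 2) (sym eq)) odd%2≡1))
  where
  odd%2≡1 : suc (k + k) % 2 ≡ 1
  odd%2≡1 = trans (cong (λ t → suc t % 2) (k+k≡k*2 k)) ([m+kn]%n≡m%n 1 k 2)

odd-3^a*u<3^[1+a]⇒u≡1 : ∀ k a u → suc (k + k) ≡ 3 ^ a * u → suc (k + k) < 3 ^ suc a → u ≡ 1
odd-3^a*u<3^[1+a]⇒u≡1 k a zero    eq _ = ⊥-elim (ℕ.1+n≢0 (trans eq (ℕ.*-zeroʳ (3 ^ a))))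
odd-3^a*u<3^[1+a]⇒u≡1 k a 1       _  _ = refl
odd-3^a*u<3^[1+a]⇒u≡1 k a 2       eq _ = ⊥-elim (odd≢even k (3 ^ a) eq)
odd-3^a*u<3^[1+a]⇒u≡1 k a (suc (suc (suc w))) eq lt =
  ⊥-elim (ℕ.<⇒≱ lt (subst (3 ^ suc a ≤_) (sym eq)
    (subst (_≤ 3 ^ a * suc (suc (suc w))) (ℕ.*-comm (3 ^ a) 3)
           (ℕ.*-monoʳ-≤ (3 ^ a) (s≤s (s≤s (s≤s z≤n)))))))

odd-valuation< : ∀ k a v u → suc (k + k) ≡ 3 ^ v * u → suc (k + k) < 3 ^ suc a →
                 suc (k + k) ≢ 3 ^ a → v < a
odd-valuation< k a v u D≡ D< D≢3^a = ℕ.≤∧≢⇒< v≤a v≢a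
  where
  v≤a : v ≤ a
  v≤a with v ℕ.≤? a
  ... | yes v≤a = v≤a
  ... | no  v≰a = ⊥-elim (ℕ.<⇒≱ D< (ℕ.≤-trans (ℕ.^-monoʳ-≤ 3 (ℕ.≰⇒> v≰a))
                                    (subst (3 ^ v ≤_) (sym D≡) (ℕ.m≤m*n (3 ^ v) u {{u≢0}}))))
    where
    u≢0 : NonZero u
    u≢0 = ℕ.m*n≢0⇒n≢0 (3 ^ v) {{subst NonZero D≡ _}}
  v≢a : v ≢ a
  v≢a refl = D≢3^a (trans D≡ (trans (cong (3 ^ v *_) (odd-3^a*u<3^[1+a]⇒u≡1 k v u D≡ D<))
                                    (ℕ.*-identityʳ (3 ^ v))))

maximal-power-of-3 : ∀ n → 2 ≤ n → ∃₂ λ a m → 1 ≤ a × suc (m + m) ≡ 3 ^ a × m < n ×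
                                              (∀ k → k < n → suc (k + k) < 3 ^ suc a)
maximal-power-of-3 (suc n) (s≤s 1≤n) with pow-bracket 3 (s≤s (s≤s z≤n)) (suc (n + n)) (s≤s z≤n)
... | a , 3^a≤2n+1 , 2n+1<3^[1+a] with 3^-odd a
...   | m , 2m+1≡3^a = a , m , 1≤a , 2m+1≡3^a , m<1+n , odd<3^[1+a]
  where
  1≤a : 1 ≤ a
  1≤a = ℕ.n≢0⇒n>0 λ a≡0 → ℕ.<⇒≱ (subst (λ a → suc (n + n) < 3 ^ suc a) a≡0 2n+1<3^[1+a])
                                   (s≤s (ℕ.+-mono-≤ 1≤n 1≤n))
  m<1+n : m < suc n
  m<1+n with m ℕ.≤? n
  ... | yes m≤n = s≤s m≤n
  ... | no  m≰n = ⊥-elim (ℕ.<⇒≱ (s≤s (ℕ.+-mono-< (ℕ.≰⇒> m≰n) (ℕ.≰⇒> m≰n)))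
                                (subst (_≤ suc (n + n)) (sym 2m+1≡3^a) 3^a≤2n+1))
  odd<3^[1+a] : ∀ k → k < suc n → suc (k + k) < 3 ^ suc a
  odd<3^[1+a] k (s≤s k≤n) = ℕ.≤-<-trans (s≤s (ℕ.+-mono-≤ k≤n k≤n)) 2n+1<3^[1+a]

module ScaledStarSum (n a m : ℕ) (2m+1≡3^a : suc (m + m) ≡ 3 ^ a) (m<n : m < n)
                     (odd<3^[1+a] : ∀ k → k < n → suc (k + k) < 3 ^ suc a) where

  open Residue prime[3]

  pow3 : ℕ → ℚ
  pow3 e = + (3 ^ e) / 1

  pow3-+ : ∀ e f → pow3 (e + f) ≡ pow3 e ℚ.* pow3 f
  pow3-+ e f = sym (trans (+/-* (3 ^ e) 0 (3 ^ f) 0) (cong (λ N → + N / 1) (sym (ℕ.^-distribˡ-+-* 3 e f))))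

  term : ℕ → ℕ → ℚ
  term k s = pow3 (a * s) ℚ.* oddInvPow k s

  term≡ : ∀ k s → term k s ≡ (+ (3 ^ (a * s)) / suc (k + k) ^ s) {{ℕ.m^n≢0 (suc (k + k)) s}}
  term≡ k s = +/1-*-1/ (3 ^ (a * s)) (suc (k + k) ^ s) {{ℕ.m^n≢0 (suc (k + k)) s}}

  term-hasResidue-1 : ∀ s → HasResidue (term m s) 1
  term-hasResidue-1 s = subst (λ q → HasResidue q 1) (sym (term≡ m s))
    (≡-hasResidue-1 _ _ {{ℕ.m^n≢0 (suc (m + m)) s}}
      (trans (sym (ℕ.^-*-assoc 3 a s)) (cong (_^ s) (sym 2m+1≡3^a))))

  term-hasResidue-0 : ∀ k s → k < n → k ≢ m → 1 ≤ s → HasResidue (term k s) 0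
  term-hasResidue-0 k s k<n k≢m 1≤s with p-power-decomposition (suc (k + k)) (s≤s z≤n)
  ... | v , u , D≡3^v*u , 3∤u = subst (λ q → HasResidue q 0) (sym (term≡ k s))
    (p^/-hasResidue-0 (a * s) (v * s) (u ^ s) (suc (k + k) ^ s) {{ℕ.m^n≢0 (suc (k + k)) s}}
      D^s≡ (p∤^ s 3∤u) (ℕ.*-monoˡ-< s {{>-nonZero 1≤s}} v<a))
    where
    v<a : v < a
    v<a = odd-valuation< k a v u D≡3^v*u (odd<3^[1+a] k k<n)
            (λ D≡3^a → k≢m (double-injective (ℕ.suc-injective (trans D≡3^a (sym 2m+1≡3^a)))))
    D^s≡ : suc (k + k) ^ s ≡ 3 ^ (v * s) * u ^ s
    D^s≡ = trans (cong (_^ s) D≡3^v*u)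
                 (trans (^-distribʳ-* (3 ^ v) u s) (cong (_* u ^ s) (ℕ.^-*-assoc 3 v s)))

  scaled : ∀ {r} → ℕ → Vec ℕ r → ℚ
  scaled lo ss = pow3 (a * sum ss) ℚ.* starSumFrom n lo ss

  scaled-∷ : ∀ {r} lo s (ss : Vec ℕ r) →
             scaled lo (s ∷ ss) ≡ sumFrom lo n (λ k → term k s ℚ.* scaled k ss)
  scaled-∷ lo s ss = begin
    pow3 (a * (s + sum ss)) ℚ.* sumFrom lo n (λ k → oddInvPow k s ℚ.* starSumFrom n k ss)
      ≡⟨ cong (ℚ._* _) (trans (cong pow3 (ℕ.*-distribˡ-+ a s (sum ss))) (pow3-+ (a * s) (a * sum ss))) ⟩
    (pow3 (a * s) ℚ.* pow3 (a * sum ss)) ℚ.* sumFrom lo n (λ k → oddInvPow k s ℚ.* starSumFrom n k ss)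
      ≡⟨ sumFrom-*ˡ (pow3 (a * s) ℚ.* pow3 (a * sum ss)) {λ k → oddInvPow k s ℚ.* starSumFrom n k ss}
                    lo n
           (λ k → interchange (pow3 (a * s)) (pow3 (a * sum ss)) (oddInvPow k s) (starSumFrom n k ss)) ⟩
    sumFrom lo n (λ k → term k s ℚ.* scaled k ss)
      ∎
    where
    open ≡-Reasoning
    open CommSemigroupProperties (CommutativeMonoid.commutativeSemigroup ℚ.*-1-commutativeMonoid)

  [_≤m] : ℕ → ℕ
  [ k ≤m] = if does (k ≤? m) then 1 else 0

  [≤m]-yes : ∀ {k} → k ≤ m → [ k ≤m] ≡ 1
  [≤m]-yes k≤m rewrite dec-true (_ ≤? m) k≤m = refl

  [≤m]-no : ∀ {k} → m < k → [ k ≤m] ≡ 0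
  [≤m]-no m<k rewrite dec-false (_ ≤? m) (ℕ.<⇒≱ m<k) = refl

  -- Tuples lo ≤ k₁ ≤ ⋯ ≤ k_r include the unit tuple (m, …, m) exactly when lo ≤ m.
  starResidue : ∀ {r} → ℕ → Vec ℕ r → ℕ
  starResidue lo []      = 1
  starResidue lo (_ ∷ _) = [ lo ≤m]

  starResidue-m : ∀ {r} (ss : Vec ℕ r) → starResidue m ss ≡ 1
  starResidue-m []      = refl
  starResidue-m (_ ∷ _) = [≤m]-yes ℕ.≤-refl

  scaled-hasResidue : ∀ {r} (ss : Vec ℕ r) → (∀ i → 1 ≤ lookup ss i) →
                      ∀ lo → HasResidue (scaled lo ss) (starResidue lo ss)
  scaled-hasResidue [] _ lo rewrite ℕ.*-zeroʳ a = 1-hasResidue-1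
  scaled-hasResidue (s ∷ ss) 1≤ss lo = subst (λ q → HasResidue q [ lo ≤m]) (sym (scaled-∷ lo s ss))
    (downwardInduction (λ k → HasResidue (sumFrom k n g) [ k ≤m]) n base step lo)
    where
    g : ℕ → ℚ
    g k = term k s ℚ.* scaled k ss
    ih : ∀ k → HasResidue (scaled k ss) (starResidue k ss)
    ih = scaled-hasResidue ss (λ i → 1≤ss (suc i))
    base : ∀ k → n ≤ k → HasResidue (sumFrom k n g) [ k ≤m]
    base k n≤k rewrite sumFrom-≥ g n≤k | [≤m]-no (ℕ.<-≤-trans m<n n≤k) = 0-hasResidue-0
    diagonal : 1 * starResidue m ss + [ suc m ≤m] ≡ [ m ≤m]
    diagonal rewrite starResidue-m ss | [≤m]-no (ℕ.n<1+n m) | [≤m]-yes (ℕ.≤-refl {m}) = refl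
    step : ∀ k → k < n → HasResidue (sumFrom (suc k) n g) [ suc k ≤m] →
           HasResidue (sumFrom k n g) [ k ≤m]
    step k k<n rest rewrite sumFrom-< g k<n with ℕ.<-cmp k m
    ... | tri< k<m _ _ = subst (HasResidue _) (trans ([≤m]-yes k<m) (sym ([≤m]-yes (ℕ.<⇒≤ k<m))))
      (HasResidue-+ (HasResidue-* (term-hasResidue-0 k s k<n (ℕ.<⇒≢ k<m) (1≤ss zero)) (ih k)) rest)
    ... | tri≈ _ refl _ = subst (HasResidue _) diagonal
      (HasResidue-+ (HasResidue-* (term-hasResidue-1 s) (ih k)) rest)
    ... | tri> _ _ m<k = subst (HasResidue _) (trans ([≤m]-no (ℕ.m<n⇒m<1+n m<k)) (sym ([≤m]-no m<k)))
      (HasResidue-+ (HasResidue-* (term-hasResidue-0 k s k<n (ℕ.>⇒≢ m<k) (1≤ss zero)) (ih k)) rest)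

theorem1p1 : (r n : ℕ) → (s : Vec ℕ r) → 1 ≤ r → r ≤ n → (∀ i → 1 ≤ lookup s i) →
    n ≥ 2 → ¬ IsInteger (oddMHStarSum n s)
theorem1p1 (suc r) n s@(s₀ ∷ ss) _ _ 1≤s n≥2 (z , H≡z) with maximal-power-of-3 n n≥2
... | a , m , 1≤a , 2m+1≡3^a , m<n , odd<3^[1+a] =
  multiple-¬hasResidue-1 (3 ^ (a * sum s)) z (∣^ 1≤a·Σs) 3^[a·Σs]z-hasResidue-1
  where
  open Residue prime[3]
  open ScaledStarSum n a m 2m+1≡3^a m<n odd<3^[1+a]
  1≤a·Σs : 1 ≤ a * sum s
  1≤a·Σs = ℕ.*-mono-≤ 1≤a (ℕ.≤-trans (1≤s zero) (ℕ.m≤m+n s₀ (sum ss)))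
  3^[a·Σs]z-hasResidue-1 : HasResidue (pow3 (a * sum s) ℚ.* (z / 1)) 1
  3^[a·Σs]z-hasResidue-1 =
    subst (λ q → HasResidue (pow3 (a * sum s) ℚ.* q) 1) H≡z (scaled-hasResidue s 1≤s 0)
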